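{- Let $n\ge 2$ and let $c$ be the number of pairs $(\overline{n},\mathcal{M})$, where $\overline{n}=(\overline{n}_1,\overline{n}_2)\in\mathbb{N}_{>0}^2$ with $\overline{n}_1+\overline{n}_2=n$ and $\mathcal{M}\in\mathbb{N}^{r\times 2}$ for some $r\ge 1$ with rows $m^1,\dots,m^r$, satisfying (II') $0\le m^i_j\le\overline{n}_j$ for all $1\le i\le r$, $j\in\{1,2\}$; (III') $m^i_1>m^{i+1}_1$ and $m^i_2<m^{i+1}_2$ for all $1\le i\le r-1$; (IV') there is an index $1\le h\le r$ such that for $m':=m^h+(-1,1)$ or for $m':=m^h+(1,-1)$ we have $(0,0)\preceq m'\preceq\overline{n}$ and $m^{h'}\not\succeq m'$ for all $1\le h'\le r$; and additionally $\overline{n}_1=\overline{n}_2$ and $(m^1_1,\dots,m^r_1)=(m^r_2,\dots,m^1_2)$ (i.e., $\mathcal{M}$ is unchanged by swapping its two columns and reversing the order of its rows). Then $c=0$ if $n$ is odd, and $c=2^{m+1}-2m-2$ if $n$ is even, where $m=n/2$.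
   Context: For $x,y\in\mathbb{Z}^2$, $x\preceq y$ (equivalently $y\succeq x$) means $x_1\le y_1$ and $x_2\le y_2$. -}

module Defs where

open import Data.Bool using (Bool; true; false; _∧_; _∨_; not; T)
open import Data.Nat as ℕ using (ℕ; zero; suc)
open import Data.Integer as ℤ using (ℤ; +_)
open import Data.Product using (_×_; _,_; Σ)
open import Data.List using (List; []; _∷_; map; reverse)
open import Data.Bool.ListAction using (all; any)

Pt : Set
Pt = ℤ × ℤ

_⪯ᵇ_ : Pt → Pt → Bool
(x₁ , x₂) ⪯ᵇ (y₁ , y₂) = (x₁ ℤ.≤ᵇ y₁) ∧ (x₂ ℤ.≤ᵇ y₂)

toPt : ℕ × ℕ → Pt
toPt (a , b) = (+ a , + b)

Candidate : Set
Candidate = (ℕ × ℕ) × List (ℕ × ℕ)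

eqListℕ : List ℕ → List ℕ → Bool
eqListℕ []       []       = true
eqListℕ (x ∷ xs) (y ∷ ys) = (x ℕ.≡ᵇ y) ∧ eqListℕ xs ys
eqListℕ _        _        = false

nonEmpty : List (ℕ × ℕ) → Bool
nonEmpty []      = false
nonEmpty (_ ∷ _) = true

-- (II') 0 ≤ mⁱⱼ ≤ n̄ⱼ  (0 ≤ is automatic in ℕ)
condII : ℕ × ℕ → List (ℕ × ℕ) → Bool
condII (a , b) M = all (λ { (x , y) → (x ℕ.≤ᵇ a) ∧ (y ℕ.≤ᵇ b) }) M

condIII : List (ℕ × ℕ) → Bool
condIII []                               = true
condIII (_ ∷ [])                         = true
condIII ((x , y) ∷ ((x' , y') ∷ rest)) =
  (x' ℕ.<ᵇ x) ∧ (y ℕ.<ᵇ y') ∧ condIII ((x' , y') ∷ rest)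

admissible : ℕ × ℕ → List (ℕ × ℕ) → Pt → Bool
admissible nbar M m' =
  ((+ 0 , + 0) ⪯ᵇ m') ∧ (m' ⪯ᵇ toPt nbar)
  ∧ all (λ r → not (m' ⪯ᵇ toPt r)) M

condIV : ℕ × ℕ → List (ℕ × ℕ) → Bool
condIV nbar M = any (λ { (x , y) →
    admissible nbar M (+ x ℤ.- + 1 , + y ℤ.+ + 1)
  ∨ admissible nbar M (+ x ℤ.+ + 1 , + y ℤ.- + 1) }) M

symmetric : List (ℕ × ℕ) → Bool
symmetric M = eqListℕ (map (λ { (x , _) → x }) M) (reverse (map (λ { (_ , y) → y }) M))

valid : ℕ → Candidate → Bool
valid n ((a , b) , M) =
  (1 ℕ.≤ᵇ a) ∧ (1 ℕ.≤ᵇ b) ∧ ((a ℕ.+ b) ℕ.≡ᵇ n)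
  ∧ nonEmpty M
  ∧ condII (a , b) M ∧ condIII M ∧ condIV (a , b) M
  ∧ (a ℕ.≡ᵇ b) ∧ symmetric M

Pairs : ℕ → Set
Pairs n = Σ Candidate (λ p → T (valid n p))

-- For n = 2m the symmetric matrices 𝓜 with n̄ = (m , m) are exactly the matrices whose first
-- column is a nonempty subset S ⊆ {0, …, m} listed in decreasing order and whose second column is
-- S listed in increasing order; (II') and (III') then hold automatically. Because 𝓜 is a
-- staircase, (IV') with mʰ + (-1 , 1) says that some x₀ + 1 ∈ S has x₀ ∉ S and the second entry
-- of its row is below m, and by the symmetry the variant with mʰ + (1 , -1) says the same. Such
-- a gap exists unless S is empty or an interval containing 0 or m, which leaves 2^(m+1) - 2(m + 1)
-- subsets. For odd n the condition n̄₁ = n̄₂ is impossible.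
module Submission where

open import Defs
open import Data.Bool using (Bool; true; false; _∧_; _∨_; not; T; if_then_else_)
open import Data.Bool.Properties using (T-∧; T-∨; T-irrelevant)
open import Data.Nat as ℕ using (ℕ; zero; suc; _+_; _*_; _∸_; _^_; _≤_; _<_; z≤n; s≤s)
open import Data.Nat.Properties
open import Data.List using (List; []; _∷_; _∷ʳ_; null; downFrom; map; zip; reverse; length)
open import Data.List.Properties using (unfold-reverse; reverse-involutive; length-reverse; zip-flip)
open import Data.List.Membership.Propositional using (_∈_; _∉_; find; lose)
open import Data.List.Membership.Propositional.Properties using (∈-downFrom⁺; ∈-downFrom⁻; ∈-map⁺)
open import Data.List.Relation.Unary.Any.Properties using (reverse⁻; any⁺; any⁻)
open import Data.List.Relation.Unary.Any using (here; there)
import Data.List.Relation.Unary.All as All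
open import Data.List.Relation.Unary.All.Properties using (all⁺; all⁻)
open import Data.List.Relation.Unary.Linked using (Linked; []; [-]; _∷_)
open import Data.Fin using (Fin)
open import Data.Fin.Properties using (+↔⊎; 0↔⊥; 1↔⊤)
import Data.Product as Product
open import Data.Product using (swap; Σ; ∃-syntax; _×_; _,_; proj₁; proj₂)
open import Data.Sum using (_⊎_; inj₁; inj₂; [_,_]′)
open import Data.Sum.Function.Propositional using (_⊎-↔_)
open import Function using (_∘_; _⇔_; Equivalence; mk⇔)
open import Function.Bundles using (_↔_; mk↔ₛ′)
open import Function.Properties.Inverse using (↔-trans; ↔-sym)
open import Data.Empty using (⊥; ⊥-elim)
open import Relation.Nullary using (¬_; yes; no; contradiction)
open import Relation.Binary.PropositionalEquality
open import Data.Integer as ℤ using ()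
open import Data.Nat.Divisibility using (_∣_; ∣1⇒≡1; ∣m+n∣m⇒∣n; m∣m*n)
open import Data.Nat.Solver using (module +-*-Solver)
open +-*-Solver using (solve; _:+_; _:*_; _:=_; con)
open import Algebra.Properties.CommutativeSemigroup +-commutativeSemigroup using (interchange)

-- The left operand is explicit where unification cannot recover it from T (a ∧ b) or T (a ∨ b).
∧⁻ : ∀ a {b} → T (a ∧ b) → T a × T b
∧⁻ a = Equivalence.to (T-∧ {a})

∧⁺ : ∀ {a b} → T a → T b → T (a ∧ b)
∧⁺ p q = Equivalence.from T-∧ (p , q)

∨⁻ : ∀ a {b} → T (a ∨ b) → T a ⊎ T b
∨⁻ a = Equivalence.to (T-∨ {a})

∨⁺ˡ : ∀ {a b} → T a → T (a ∨ b)
∨⁺ˡ p = Equivalence.from T-∨ (inj₁ p)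

∨⁺ʳ : ∀ a {b} → T b → T (a ∨ b)
∨⁺ʳ a p = Equivalence.from (T-∨ {a}) (inj₂ p)

T-not⁺ : ∀ {b} → ¬ T b → T (not b)
T-not⁺ {false} _  = _
T-not⁺ {true}  ¬t = ¬t _

T-not⁻ : ∀ {b} → T (not b) → ¬ T b
T-not⁻ {false} _ ()

-- Counting subsets

-- Strictly descending lists with entries below k encode the subsets of {0, …, k - 1}.
data Desc : ℕ → List ℕ → Set where
  []  : ∀ {k} → Desc k []
  _∷_ : ∀ {k x xs} → x < k → Desc x xs → Desc k (x ∷ xs)

Desc-irrelevant : ∀ {k xs} (d e : Desc k xs) → d ≡ e
Desc-irrelevant []      []      = refl
Desc-irrelevant (p ∷ d) (q ∷ e) = cong₂ _∷_ (<-irrelevant p q) (Desc-irrelevant d e)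

Desc-mono : ∀ {k l xs} → k ≤ l → Desc k xs → Desc l xs
Desc-mono k≤l []        = []
Desc-mono k≤l (x<k ∷ d) = <-≤-trans x<k k≤l ∷ d

Desc-∈ : ∀ {k xs z} → Desc k xs → z ∈ xs → z < k
Desc-∈ (x<k ∷ d) (here refl) = x<k
Desc-∈ (x<k ∷ d) (there z∈) = <-trans (Desc-∈ d z∈) x<k

Subsets : ℕ → (List ℕ → Bool) → Set
Subsets k P = Σ (List ℕ) λ xs → Desc k xs × T (P xs)

Subsets-≡ : ∀ {k P xs ys} {d : Desc k xs} {e : Desc k ys} {p : T (P xs)} {q : T (P ys)} →
            xs ≡ ys → _≡_ {A = Subsets k P} (xs , d , p) (ys , e , q)
Subsets-≡ refl = cong₂ (λ d p → _ , d , p) (Desc-irrelevant _ _) (T-irrelevant _ _)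

Subsets-zero↔ : ∀ P → Subsets 0 P ↔ T (P [])
Subsets-zero↔ P = mk↔ₛ′ to (λ p → [] , [] , p) (λ _ → refl) from∘to
  where
  to : Subsets 0 P → T (P [])
  to ([] , [] , p) = p
  from∘to : ∀ s → ([] , [] , to s) ≡ s
  from∘to ([] , [] , p) = refl

Subsets-suc↔ : ∀ k P → Subsets (suc k) P ↔ (Subsets k (P ∘ (k ∷_)) ⊎ Subsets k P)
Subsets-suc↔ k P = mk↔ₛ′ to from to∘from from∘to
  where
  to : Subsets (suc k) P → Subsets k (P ∘ (k ∷_)) ⊎ Subsets k P
  to ([] , [] , p) = inj₂ ([] , [] , p)
  to (x ∷ xs , x<1+k ∷ d , p) with x ≟ k
  ... | yes refl = inj₁ (xs , d , p)
  ... | no x≢k   = inj₂ (x ∷ xs , ≤∧≢⇒< (≤-pred x<1+k) x≢k ∷ d , p)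

  from : Subsets k (P ∘ (k ∷_)) ⊎ Subsets k P → Subsets (suc k) P
  from (inj₁ (xs , d , p)) = k ∷ xs , n<1+n k ∷ d , p
  from (inj₂ (xs , d , p)) = xs , Desc-mono (n≤1+n k) d , p

  to∘from : ∀ s → to (from s) ≡ s
  to∘from (inj₁ (xs , d , p)) with k ≟ k
  ... | yes refl = refl
  ... | no k≢k   = contradiction refl k≢k
  to∘from (inj₂ ([] , [] , p)) = refl
  to∘from (inj₂ (x ∷ xs , x<k ∷ d , p)) with x ≟ k
  ... | yes refl = contradiction x<k (n≮n x)
  ... | no _     = cong inj₂ (Subsets-≡ refl)

  from∘to : ∀ s → from (to s) ≡ s
  from∘to ([] , [] , p) = refl
  from∘to (x ∷ xs , x<1+k ∷ d , p) with x ≟ k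
  ... | yes refl = Subsets-≡ refl
  ... | no _     = Subsets-≡ refl

count : ℕ → (List ℕ → Bool) → ℕ
count zero    P = if P [] then 1 else 0
count (suc k) P = count k (P ∘ (k ∷_)) + count k P

T↔Fin : ∀ b → T b ↔ Fin (if b then 1 else 0)
T↔Fin true  = ↔-sym 1↔⊤
T↔Fin false = ↔-sym 0↔⊥

Subsets↔count : ∀ k P → Subsets k P ↔ Fin (count k P)
Subsets↔count zero    P = ↔-trans (Subsets-zero↔ P) (T↔Fin (P []))
Subsets↔count (suc k) P = ↔-trans (Subsets-suc↔ k P)
  (↔-trans (Subsets↔count k (P ∘ (k ∷_)) ⊎-↔ Subsets↔count k P) (↔-sym +↔⊎))

count-cong : ∀ k {P Q} → (∀ {xs} → Desc k xs → P xs ≡ Q xs) → count k P ≡ count k Q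
count-cong zero    P≡Q = cong (if_then 1 else 0) (P≡Q [])
count-cong (suc k) P≡Q = cong₂ _+_
  (count-cong k (λ d → P≡Q (n<1+n k ∷ d)))
  (count-cong k (λ d → P≡Q (Desc-mono (n≤1+n k) d)))

count-complement : ∀ k P → count k P + count k (not ∘ P) ≡ 2 ^ k
count-complement zero P with P []
... | true  = refl
... | false = refl
count-complement (suc k) P = begin
  (count k P₁ + count k P) + (count k (not ∘ P₁) + count k (not ∘ P))
    ≡⟨ interchange (count k P₁) _ _ _ ⟩
  (count k P₁ + count k (not ∘ P₁)) + (count k P + count k (not ∘ P))
    ≡⟨ cong₂ _+_ (count-complement k P₁) (count-complement k P) ⟩
  2 ^ k + 2 ^ k
    ≡⟨ cong (2 ^ k +_) (sym (+-identityʳ (2 ^ k))) ⟩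
  2 ^ suc k ∎
  where
  open ≡-Reasoning
  P₁ = P ∘ (k ∷_)

count-false : ∀ k → count k (λ _ → false) ≡ 0
count-false zero    = refl
count-false (suc k) = cong₂ _+_ (count-false k) (count-false k)

count-null : ∀ k → count k null ≡ 1
count-null zero    = refl
count-null (suc k) = cong₂ _+_ (count-false k) (count-null k)

-- End segments

≡ᵇ-refl : ∀ k → (k ℕ.≡ᵇ k) ≡ true
≡ᵇ-refl zero    = refl
≡ᵇ-refl (suc k) = ≡ᵇ-refl k

<⇒≡ᵇ-false : ∀ {x k} → x < k → (x ℕ.≡ᵇ k) ≡ false
<⇒≡ᵇ-false {zero}  {suc k} _         = refl
<⇒≡ᵇ-false {suc x} {suc k} (s≤s x<k) = <⇒≡ᵇ-false x<k

-- isUpperSegment k xs  iff  xs = k - 1, k - 2, …, lo  for some lo ≤ k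
isUpperSegment : ℕ → List ℕ → Bool
isUpperSegment k []       = true
isUpperSegment k (x ∷ xs) = (suc x ℕ.≡ᵇ k) ∧ isUpperSegment x xs

isDownFrom : ℕ → List ℕ → Bool
isDownFrom zero    xs       = null xs
isDownFrom (suc k) []       = false
isDownFrom (suc k) (x ∷ xs) = (x ℕ.≡ᵇ k) ∧ isDownFrom k xs

isLowerSegment : List ℕ → Bool
isLowerSegment []       = true
isLowerSegment (x ∷ xs) = isDownFrom x xs

isEndSegment : ℕ → List ℕ → Bool
isEndSegment k xs = isUpperSegment k xs ∨ isLowerSegment xs

count-isDownFrom : ∀ k → count k (isDownFrom k) ≡ 1
count-isDownFrom zero    = refl
count-isDownFrom (suc k) = begin
  count k (isDownFrom (suc k) ∘ (k ∷_)) + count k (isDownFrom (suc k))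
    ≡⟨ cong₂ _+_ (count-cong k (λ {ys} _ → cong (_∧ isDownFrom k ys) (≡ᵇ-refl k)))
                 (count-cong k below) ⟩
  count k (isDownFrom k) + count k (λ _ → false)
    ≡⟨ cong₂ _+_ (count-isDownFrom k) (count-false k) ⟩
  1 ∎
  where
  open ≡-Reasoning
  below : ∀ {ys} → Desc k ys → isDownFrom (suc k) ys ≡ false
  below []                  = refl
  below {y ∷ ys} (y<k ∷ _) = cong (_∧ isDownFrom k ys) (<⇒≡ᵇ-false y<k)

count-isUpperSegment : ∀ k → count k (isUpperSegment k) ≡ suc k
count-isUpperSegment zero    = refl
count-isUpperSegment (suc k) = begin
  count k (isUpperSegment (suc k) ∘ (k ∷_)) + count k (isUpperSegment (suc k))
    ≡⟨ cong₂ _+_ (count-cong k (λ {ys} _ → cong (_∧ isUpperSegment k ys) (≡ᵇ-refl k)))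
                 (count-cong k below) ⟩
  count k (isUpperSegment k) + count k null
    ≡⟨ cong₂ _+_ (count-isUpperSegment k) (count-null k) ⟩
  suc k + 1
    ≡⟨ +-comm (suc k) 1 ⟩
  suc (suc k) ∎
  where
  open ≡-Reasoning
  below : ∀ {ys} → Desc k ys → isUpperSegment (suc k) ys ≡ null ys
  below []                  = refl
  below {y ∷ ys} (y<k ∷ _) = cong (_∧ isUpperSegment y ys) (<⇒≡ᵇ-false y<k)

count-isLowerSegment : ∀ k → count k isLowerSegment ≡ suc k
count-isLowerSegment zero    = refl
count-isLowerSegment (suc k) = cong₂ _+_ (count-isDownFrom k) (count-isLowerSegment k)

isDownFrom⇒isUpperSegment : ∀ k xs → T (isDownFrom k xs) → T (isUpperSegment k xs)
isDownFrom⇒isUpperSegment zero    []       _ = _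
isDownFrom⇒isUpperSegment (suc k) (x ∷ xs) t
  with x≡ᵇk , t′ ← ∧⁻ (x ℕ.≡ᵇ k) t
  with refl ← ≡ᵇ⇒≡ x k x≡ᵇk =
  ∧⁺ x≡ᵇk (isDownFrom⇒isUpperSegment x xs t′)

∨-absorbs : ∀ {a} b → (T b → T a) → (a ∨ b) ≡ a
∨-absorbs {true}  _     _   = refl
∨-absorbs {false} false _   = refl
∨-absorbs {false} true  b⇒a = ⊥-elim (b⇒a _)

count-isEndSegment : ∀ k → count (suc k) (isEndSegment (suc k)) ≡ suc k + suc k
count-isEndSegment k = cong₂ _+_
  (trans (count-cong k with-k) (count-isUpperSegment k))
  (trans (count-cong k without-k) (count-isLowerSegment k))
  where
  with-k : ∀ {ys} → Desc k ys → isEndSegment (suc k) (k ∷ ys) ≡ isUpperSegment k ys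
  with-k {ys} _ rewrite ≡ᵇ-refl k = ∨-absorbs (isDownFrom k ys) (isDownFrom⇒isUpperSegment k ys)
  without-k : ∀ {ys} → Desc k ys → isEndSegment (suc k) ys ≡ isLowerSegment ys
  without-k []                  = refl
  without-k {y ∷ ys} (y<k ∷ _) rewrite <⇒≡ᵇ-false y<k = refl

count-¬isEndSegment : ∀ m → count (suc m) (not ∘ isEndSegment (suc m)) ≡ 2 ^ (m + 1) ∸ 2 * m ∸ 2
count-¬isEndSegment m = begin
  count (suc m) (not ∘ E)
    ≡⟨ m+n∸m≡n (count (suc m) E) _ ⟨
  (count (suc m) E + count (suc m) (not ∘ E)) ∸ count (suc m) E
    ≡⟨ cong₂ _∸_ (count-complement (suc m) E) (count-isEndSegment m) ⟩
  2 ^ suc m ∸ (suc m + suc m)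
    ≡⟨ cong₂ (λ k l → 2 ^ k ∸ l) (+-comm 1 m)
             (solve 1 (λ m → (con 1 :+ m) :+ (con 1 :+ m) := con 2 :* m :+ con 2) refl m) ⟩
  2 ^ (m + 1) ∸ (2 * m + 2)
    ≡⟨ ∸-+-assoc (2 ^ (m + 1)) (2 * m) 2 ⟨
  2 ^ (m + 1) ∸ 2 * m ∸ 2 ∎
  where
  open ≡-Reasoning
  E = isEndSegment (suc m)

-- Gaps

∉-∷ : ∀ {z h : ℕ} {xs} → z ≢ h → z ∉ xs → z ∉ h ∷ xs
∉-∷ z≢h z∉ (here z≡h) = z≢h z≡h
∉-∷ z≢h z∉ (there z∈) = z∉ z∈

Desc-∈-∷ : ∀ {h xs z} → Desc h xs → z ∈ h ∷ xs → z ≤ h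
Desc-∈-∷ d (here refl) = ≤-refl
Desc-∈-∷ d (there z∈)  = <⇒≤ (Desc-∈ d z∈)

GapAt : List ℕ → ℕ → Set
GapAt xs x₀ = suc x₀ ∈ xs × x₀ ∉ xs

InnerGap : List ℕ → Set
InnerGap xs = ∃[ x₀ ] GapAt xs x₀ × ∃[ z ] z ∈ xs × z ≤ x₀

innerGap-or-isUpperSegment : ∀ {h rest} → Desc h rest →
                             InnerGap (h ∷ rest) ⊎ T (isUpperSegment h rest)
innerGap-or-isUpperSegment [] = inj₂ _
innerGap-or-isUpperSegment {suc h₀} {x ∷ rest} (s≤s x≤h₀ ∷ d) with x ≟ h₀
... | yes refl with innerGap-or-isUpperSegment d
...   | inj₂ up rewrite ≡ᵇ-refl x = inj₂ up
...   | inj₁ (x₀ , (sx₀∈ , x₀∉) , z , z∈ , z≤x₀) =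
  inj₁ (x₀ , (there sx₀∈ , ∉-∷ (<⇒≢ (m<n⇒m<1+n (Desc-∈-∷ d sx₀∈))) x₀∉) , z , there z∈ , z≤x₀)
innerGap-or-isUpperSegment {suc h₀} {x ∷ rest} (s≤s x≤h₀ ∷ d) | no x≢h₀ =
  inj₁ (h₀ , (here refl , h₀∉) , x , there (here refl) , x≤h₀)
  where
  x<h₀ : x < h₀
  x<h₀ = ≤∧≢⇒< x≤h₀ x≢h₀
  h₀∉ : h₀ ∉ suc h₀ ∷ x ∷ rest
  h₀∉ = ∉-∷ (<⇒≢ (n<1+n h₀)) (∉-∷ (≢-sym x≢h₀) (λ h₀∈ → <-asym x<h₀ (Desc-∈ d h₀∈)))

isUpperSegment-bottomGap : ∀ {h rest} → Desc h rest → T (isUpperSegment h rest) →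
                           ¬ T (isLowerSegment (h ∷ rest)) → ∃[ x₀ ] GapAt (h ∷ rest) x₀
isUpperSegment-bottomGap {zero}   {[]} [] _ ¬low = contradiction _ ¬low
isUpperSegment-bottomGap {suc h₀} {[]} [] _ _    = h₀ , here refl , ∉-∷ (<⇒≢ (n<1+n h₀)) λ ()
isUpperSegment-bottomGap {h} {x ∷ rest} (_ ∷ d) up ¬low
  with 1+x≡ᵇh , up′ ← ∧⁻ (suc x ℕ.≡ᵇ h) up
  with refl ← ≡ᵇ⇒≡ (suc x) h 1+x≡ᵇh
  with x₀ , sx₀∈ , x₀∉ ← isUpperSegment-bottomGap d up′ (λ low → ¬low (∧⁺ (≡⇒≡ᵇ x x refl) low)) =
  x₀ , there sx₀∈ , ∉-∷ (<⇒≢ (m<n⇒m<1+n (Desc-∈-∷ d sx₀∈))) x₀∉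

Interval : List ℕ → ℕ → ℕ → Set
Interval xs lo hi = ∀ {z} → z ∈ xs ⇔ (lo ≤ z × z < hi)

interval-∷ : ∀ {x xs lo} → lo ≤ x → Interval xs lo x → Interval (x ∷ xs) lo (suc x)
interval-∷ {x} {xs} {lo} lo≤x I = mk⇔ to from
  where
  to : ∀ {z} → z ∈ x ∷ xs → lo ≤ z × z < suc x
  to (here refl) = lo≤x , n<1+n x
  to (there z∈) with lo≤z , z<x ← Equivalence.to I z∈ = lo≤z , m<n⇒m<1+n z<x
  from : ∀ {z} → lo ≤ z × z < suc x → z ∈ x ∷ xs
  from {z} (lo≤z , z<1+x) with z ≟ x
  ... | yes z≡x = here z≡x
  ... | no z≢x  = there (Equivalence.from I (lo≤z , ≤∧≢⇒< (≤-pred z<1+x) z≢x))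

isDownFrom⇒≡downFrom : ∀ k xs → T (isDownFrom k xs) → xs ≡ downFrom k
isDownFrom⇒≡downFrom zero    []       _ = refl
isDownFrom⇒≡downFrom (suc k) (x ∷ xs) t with x≡ᵇk , t′ ← ∧⁻ (x ℕ.≡ᵇ k) t =
  cong₂ _∷_ (≡ᵇ⇒≡ x k x≡ᵇk) (isDownFrom⇒≡downFrom k xs t′)

isLowerSegment⇒interval : ∀ xs → T (isLowerSegment xs) → ∃[ hi ] Interval xs 0 hi
isLowerSegment⇒interval []       _   = 0 , mk⇔ (λ ()) (λ ())
isLowerSegment⇒interval (x ∷ xs) low = suc x ,
  subst (λ ys → Interval (x ∷ ys) 0 (suc x)) (sym (isDownFrom⇒≡downFrom x xs low))
    (mk⇔ (λ z∈ → z≤n , ∈-downFrom⁻ z∈) (∈-downFrom⁺ ∘ proj₂))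

isUpperSegment⇒interval : ∀ k xs → T (isUpperSegment k xs) → ∃[ lo ] lo ≤ k × Interval xs lo k
isUpperSegment⇒interval k [] _ = k , ≤-refl , mk⇔ (λ ()) (λ (k≤z , z<k) → contradiction k≤z (<⇒≱ z<k))
isUpperSegment⇒interval k (x ∷ xs) up
  with 1+x≡ᵇk , up′ ← ∧⁻ (suc x ℕ.≡ᵇ k) up
  with refl ← ≡ᵇ⇒≡ (suc x) k 1+x≡ᵇk
  with lo , lo≤x , I ← isUpperSegment⇒interval x xs up′ =
  lo , m≤n⇒m≤1+n lo≤x , interval-∷ lo≤x I

interval-gap : ∀ {xs lo hi x₀} → Interval xs lo hi → GapAt xs x₀ → lo ≡ suc x₀
interval-gap {x₀ = x₀} I (sx₀∈ , x₀∉) with lo≤sx₀ , sx₀<hi ← Equivalence.to I sx₀∈ =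
  ≤-antisym lo≤sx₀ (≮⇒≥ λ lo≤x₀ → x₀∉ (Equivalence.from I (≤-pred lo≤x₀ , <-trans (n<1+n x₀) sx₀<hi)))

isUpperSegment-gap : ∀ {m xs x₀} → T (isUpperSegment (suc m) xs) → GapAt xs x₀ →
                     m ∈ xs × (∀ {z} → z ∈ xs → suc x₀ ≤ z)
isUpperSegment-gap {m} {xs} upper gap@(sx₀∈ , _)
  with lo , _ , I ← isUpperSegment⇒interval (suc m) xs upper
  with refl ← interval-gap I gap =
  Equivalence.from I (≤-pred (proj₂ (Equivalence.to I sx₀∈)) , n<1+n m) , proj₁ ∘ Equivalence.to I

isLowerSegment⇒noGap : ∀ {xs x₀} → T (isLowerSegment xs) → ¬ GapAt xs x₀
isLowerSegment⇒noGap {xs} low gap with _ , I ← isLowerSegment⇒interval xs low =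
  0≢1+n (interval-gap I gap)

¬isEndSegment⇒gap : ∀ {m xs} → Desc (suc m) xs → ¬ T (isEndSegment (suc m) xs) →
                    ∃[ x₀ ] GapAt xs x₀ × ((∃[ z ] z ∈ xs × z ≤ x₀) ⊎ m ∉ xs)
¬isEndSegment⇒gap [] ¬end = contradiction _ ¬end
¬isEndSegment⇒gap {m} {h ∷ rest} (s≤s h≤m ∷ d) ¬end with innerGap-or-isUpperSegment d
... | inj₁ (x₀ , gap , below) = x₀ , gap , inj₁ below
... | inj₂ upper with h ≟ m
...   | yes refl = contradiction (∨⁺ˡ (∧⁺ (≡⇒≡ᵇ h h refl) upper)) ¬end
...   | no h≢m
  with x₀ , gap ← isUpperSegment-bottomGap d upper (¬end ∘ ∨⁺ʳ (isUpperSegment (suc m) (h ∷ rest))) =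
  x₀ , gap , inj₂ λ m∈ → h≢m (≤-antisym h≤m (Desc-∈-∷ d m∈))

-- Symmetric staircases

∈-zip⁻ : ∀ {xs ys : List ℕ} {x y} → (x , y) ∈ zip xs ys → x ∈ xs × y ∈ ys
∈-zip⁻ {_ ∷ _} {_ ∷ _} (here refl) = here refl , here refl
∈-zip⁻ {_ ∷ _} {_ ∷ _} (there xy∈) = Product.map there there (∈-zip⁻ xy∈)

∈-zip⁺ : ∀ {xs ys : List ℕ} {x} → length xs ≡ length ys → x ∈ xs → ∃[ y ] (x , y) ∈ zip xs ys
∈-zip⁺ {_ ∷ _} {y ∷ _} _ (here refl) = y , here refl
∈-zip⁺ {_ ∷ _} {_ ∷ _} e (there x∈) = Product.map₂ there (∈-zip⁺ (suc-injective e) x∈)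

map-proj₁-zip : ∀ {xs ys : List ℕ} → length xs ≡ length ys → map proj₁ (zip xs ys) ≡ xs
map-proj₁-zip {[]}    {[]}    _ = refl
map-proj₁-zip {x ∷ _} {_ ∷ _} e = cong (x ∷_) (map-proj₁-zip (suc-injective e))

map-proj₂-zip : ∀ {xs ys : List ℕ} → length xs ≡ length ys → map proj₂ (zip xs ys) ≡ ys
map-proj₂-zip {[]}    {[]}    _ = refl
map-proj₂-zip {_ ∷ _} {y ∷ _} e = cong (y ∷_) (map-proj₂-zip (suc-injective e))

zip-map-proj : ∀ (M : List (ℕ × ℕ)) → zip (map proj₁ M) (map proj₂ M) ≡ M
zip-map-proj []      = refl
zip-map-proj (r ∷ M) = cong (r ∷_) (zip-map-proj M)

zip-∷ʳ : ∀ {xs ys : List ℕ} {x y} → length xs ≡ length ys →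
         zip (xs ∷ʳ x) (ys ∷ʳ y) ≡ zip xs ys ∷ʳ (x , y)
zip-∷ʳ {[]}    {[]}    _ = refl
zip-∷ʳ {x ∷ _} {y ∷ _} e = cong ((x , y) ∷_) (zip-∷ʳ (suc-injective e))

reverse-zip : ∀ {xs ys : List ℕ} → length xs ≡ length ys →
              reverse (zip xs ys) ≡ zip (reverse xs) (reverse ys)
reverse-zip {[]}     {[]}     _ = refl
reverse-zip {x ∷ xs} {y ∷ ys} e = begin
  reverse ((x , y) ∷ zip xs ys)         ≡⟨ unfold-reverse (x , y) (zip xs ys) ⟩
  reverse (zip xs ys) ∷ʳ (x , y)        ≡⟨ cong (_∷ʳ (x , y)) (reverse-zip {xs} {ys} e′) ⟩
  zip (reverse xs) (reverse ys) ∷ʳ (x , y)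
    ≡⟨ zip-∷ʳ (trans (length-reverse xs) (trans e′ (sym (length-reverse ys)))) ⟨
  zip (reverse xs ∷ʳ x) (reverse ys ∷ʳ y)
    ≡⟨ cong₂ zip (unfold-reverse x xs) (unfold-reverse y ys) ⟨
  zip (reverse (x ∷ xs)) (reverse (y ∷ ys)) ∎
  where
  open ≡-Reasoning
  e′ = suc-injective e

symmetricMatrix : List ℕ → List (ℕ × ℕ)
symmetricMatrix xs = zip xs (reverse xs)

symmetricMatrix-swap : ∀ {xs x y} → (x , y) ∈ symmetricMatrix xs → (y , x) ∈ symmetricMatrix xs
symmetricMatrix-swap {xs} xy∈ = reverse⁻ (subst ((_ , _) ∈_) zip≡reverse (∈-map⁺ swap xy∈))
  where
  zip≡reverse : map swap (symmetricMatrix xs) ≡ reverse (symmetricMatrix xs)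
  zip≡reverse = begin
    map swap (zip xs (reverse xs))        ≡⟨ zip-flip (reverse xs) xs ⟨
    zip (reverse xs) xs                   ≡⟨ cong (zip (reverse xs)) (reverse-involutive xs) ⟨
    zip (reverse xs) (reverse (reverse xs)) ≡⟨ reverse-zip {xs} {reverse xs} (sym (length-reverse xs)) ⟨
    reverse (zip xs (reverse xs))         ∎
    where open ≡-Reasoning

condIII-∷⁻ : ∀ {x y} rest → T (condIII ((x , y) ∷ rest)) →
             (∀ {p q} → (p , q) ∈ rest → p < x × y < q) × T (condIII rest)
condIII-∷⁻ [] _ = (λ ()) , _
condIII-∷⁻ {x} {y} ((x′ , y′) ∷ rest) c =
  let x′<ᵇx , c′   = ∧⁻ (x′ ℕ.<ᵇ x) c
      y<ᵇy′ , c″   = ∧⁻ (y ℕ.<ᵇ y′) c′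
      x′<x , y<y′  = <ᵇ⇒< x′ x x′<ᵇx , <ᵇ⇒< y y′ y<ᵇy′
      below′ , _   = condIII-∷⁻ rest c″
      below : ∀ {p q} → (p , q) ∈ (x′ , y′) ∷ rest → p < x × y < q
      below = λ { (here refl) → x′<x , y<y′
                ; (there pq∈) → Product.map (λ p<x′ → <-trans p<x′ x′<x) (<-trans y<y′) (below′ pq∈) }
  in below , c″

staircase-compare : ∀ {M x y p q} → T (condIII M) → (x , y) ∈ M → (p , q) ∈ M →
                    (x ≡ p × y ≡ q) ⊎ (p < x × y < q) ⊎ (x < p × q < y)
staircase-compare {_ ∷ M} c (here refl) (here refl) = inj₁ (refl , refl)
staircase-compare {_ ∷ M} c (here refl) (there pq∈) = inj₂ (inj₁ (proj₁ (condIII-∷⁻ M c) pq∈))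
staircase-compare {_ ∷ M} c (there xy∈) (here refl) = inj₂ (inj₂ (proj₁ (condIII-∷⁻ M c) xy∈))
staircase-compare {_ ∷ M} c (there xy∈) (there pq∈) =
  staircase-compare (proj₂ (condIII-∷⁻ M c)) xy∈ pq∈

staircase-< : ∀ {M x y p q} → T (condIII M) → (x , y) ∈ M → (p , q) ∈ M → x < p → q < y
staircase-< c xy∈ pq∈ x<p with staircase-compare c xy∈ pq∈
... | inj₁ (refl , _)       = contradiction x<p (<-irrefl refl)
... | inj₂ (inj₁ (p<x , _)) = contradiction x<p (<-asym p<x)
... | inj₂ (inj₂ (_ , q<y)) = q<y

staircase-≤ : ∀ {M x y p q} → T (condIII M) → (x , y) ∈ M → (p , q) ∈ M → x ≤ p → q ≤ y
staircase-≤ c xy∈ pq∈ x≤p with staircase-compare c xy∈ pq∈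
... | inj₁ (_ , refl)       = ≤-refl
... | inj₂ (inj₁ (p<x , _)) = contradiction x≤p (<⇒≱ p<x)
... | inj₂ (inj₂ (_ , q<y)) = <⇒≤ q<y

condIII⇒Desc : ∀ {k} M → T (condIII M) → (∀ {x y} → (x , y) ∈ M → x < k) → Desc k (map proj₁ M)
condIII⇒Desc []      _ _     = []
condIII⇒Desc (_ ∷ M) c bound =
  let below , c′ = condIII-∷⁻ M c
  in bound (here refl) ∷ condIII⇒Desc M c′ (proj₁ ∘ below)

Linked-∷ʳ : ∀ {ys x} → Linked _<_ ys → (∀ {z} → z ∈ ys → z < x) → Linked _<_ (ys ∷ʳ x)
Linked-∷ʳ []      below = [-]
Linked-∷ʳ [-]     below = below (here refl) ∷ [-]
Linked-∷ʳ (r ∷ l) below = r ∷ Linked-∷ʳ l (below ∘ there)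

Desc⇒Linked-reverse : ∀ {k xs} → Desc k xs → Linked _<_ (reverse xs)
Desc⇒Linked-reverse []                  = []
Desc⇒Linked-reverse {xs = x ∷ xs} (_ ∷ d) = subst (Linked _<_) (sym (unfold-reverse x xs))
  (Linked-∷ʳ (Desc⇒Linked-reverse d) (Desc-∈ d ∘ reverse⁻))

condIII-zip : ∀ {k xs ys} → Desc k xs → Linked _<_ ys → T (condIII (zip xs ys))
condIII-zip {xs = []}                      _ _ = _
condIII-zip {xs = _ ∷ []}     {ys = []}    _ _ = _
condIII-zip {xs = _ ∷ []}     {ys = _ ∷ _} _ _ = _
condIII-zip {xs = _ ∷ _ ∷ _}  {ys = []}    _ _ = _
condIII-zip {xs = _ ∷ _ ∷ _}  {ys = _ ∷ []} _ _ = _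
condIII-zip (_ ∷ d@(x′<x ∷ _)) (y<y′ ∷ l) = ∧⁺ (<⇒<ᵇ x′<x) (∧⁺ (<⇒<ᵇ y<y′) (condIII-zip d l))

Free : ℕ → List (ℕ × ℕ) → ℕ → ℕ → Set
Free m M a b = a ≤ m × b ≤ m × (∀ {p q} → (p , q) ∈ M → a ≤ p → b ≤ q → ⊥)

admissible⇔Free : ∀ {m M a b} → T (admissible (m , m) M (ℤ.+ a , ℤ.+ b)) ⇔ Free m M a b
admissible⇔Free {m} {M} {a} {b} = mk⇔ to from
  where
  to : T (admissible (m , m) M (ℤ.+ a , ℤ.+ b)) → Free m M a b
  to adm =
    let inBox , free = ∧⁻ ((a ℕ.≤ᵇ m) ∧ (b ℕ.≤ᵇ m)) adm
        a≤ᵇm , b≤ᵇm  = ∧⁻ (a ℕ.≤ᵇ m) inBox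
    in ≤ᵇ⇒≤ a m a≤ᵇm , ≤ᵇ⇒≤ b m b≤ᵇm ,
       λ pq∈ a≤p b≤q → T-not⁻ (All.lookup (all⁺ _ M free) pq∈) (∧⁺ (≤⇒≤ᵇ a≤p) (≤⇒≤ᵇ b≤q))
  from : Free m M a b → T (admissible (m , m) M (ℤ.+ a , ℤ.+ b))
  from (a≤m , b≤m , undominated) = ∧⁺ (∧⁺ (≤⇒≤ᵇ a≤m) (≤⇒≤ᵇ b≤m))
    (all⁻ _ {xs = M} (All.tabulate λ { {p , q} pq∈ → T-not⁺ λ a≤ᵇp∧b≤ᵇq →
      let a≤ᵇp , b≤ᵇq = ∧⁻ (a ℕ.≤ᵇ p) a≤ᵇp∧b≤ᵇq
      in undominated pq∈ (≤ᵇ⇒≤ a p a≤ᵇp) (≤ᵇ⇒≤ b q b≤ᵇq) }))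

module SymmetricStaircase (m : ℕ) (xs : List ℕ) (desc : Desc (suc m) xs) where

  M : List (ℕ × ℕ)
  M = symmetricMatrix xs

  staircase : T (condIII M)
  staircase = condIII-zip desc (Desc⇒Linked-reverse desc)

  row⇒∈ : ∀ {x y} → (x , y) ∈ M → x ∈ xs
  row⇒∈ = proj₁ ∘ ∈-zip⁻

  ∈⇒row : ∀ {x} → x ∈ xs → ∃[ y ] (x , y) ∈ M
  ∈⇒row = ∈-zip⁺ (sym (length-reverse xs))

  row-bound : ∀ {x y} → (x , y) ∈ M → x ≤ m
  row-bound = ≤-pred ∘ Desc-∈ desc ∘ row⇒∈

  column-bound : ∀ {x y} → (x , y) ∈ M → y ≤ m
  column-bound = row-bound ∘ symmetricMatrix-swap

  Free-transpose : ∀ {a b} → Free m M a b → Free m M b a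
  Free-transpose (a≤m , b≤m , undominated) =
    b≤m , a≤m , λ pq∈ b≤p a≤q → undominated (symmetricMatrix-swap pq∈) a≤q b≤p

  Gap : Set
  Gap = ∃[ x₀ ] ∃[ y ] (suc x₀ , y) ∈ M × x₀ ∉ xs × y < m

  -- For the row mʰ = (x₀ + 1 , y), the point mʰ + (-1 , 1) = (x₀ , y + 1) can only be dominated
  -- by a row with first coordinate x₀: rows with larger first coordinate have second one ≤ y.
  free⇔gap : ∀ {x₀ y} → (suc x₀ , y) ∈ M → Free m M x₀ (y + 1) ⇔ (x₀ ∉ xs × y < m)
  free⇔gap {x₀} {y} row = mk⇔ to from
    where
    y+1≡1+y = +-comm y 1
    to : Free m M x₀ (y + 1) → x₀ ∉ xs × y < m
    to (_ , y+1≤m , undominated) = x₀∉ , subst (_≤ m) y+1≡1+y y+1≤m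
      where
      x₀∉ : x₀ ∉ xs
      x₀∉ x₀∈ with q , row′ ← ∈⇒row x₀∈ =
        undominated row′ ≤-refl (subst (_≤ q) (sym y+1≡1+y) (staircase-< staircase row′ row (n<1+n x₀)))
    from : x₀ ∉ xs × y < m → Free m M x₀ (y + 1)
    from (x₀∉ , y<m) = <⇒≤ (row-bound row) , subst (_≤ m) (sym y+1≡1+y) y<m , undominated
      where
      undominated : ∀ {p q} → (p , q) ∈ M → x₀ ≤ p → y + 1 ≤ q → ⊥
      undominated {p} {q} pq∈ x₀≤p y+1≤q with p ≟ x₀
      ... | yes refl = x₀∉ (row⇒∈ pq∈)
      ... | no p≢x₀  = <⇒≱ (subst (_≤ q) y+1≡1+y y+1≤q)
                         (staircase-≤ staircase row pq∈ (≤∧≢⇒< x₀≤p (≢-sym p≢x₀)))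

  condIV⇒Gap : T (condIV (m , m) M) → Gap
  condIV⇒Gap c with (x , y) , row , adm ← find (any⁻ _ M c) =
    [ gapLeft row , gapRight row ]′ (∨⁻ (admissible (m , m) M (ℤ.+ x ℤ.- ℤ.+ 1 , ℤ.+ y ℤ.+ ℤ.+ 1)) adm)
    where
    gapLeft : ∀ {x y} → (x , y) ∈ M → T (admissible (m , m) M (ℤ.+ x ℤ.- ℤ.+ 1 , ℤ.+ y ℤ.+ ℤ.+ 1)) → Gap
    gapLeft {suc x₀} {y} row adm =
      x₀ , y , row , Equivalence.to (free⇔gap row) (Equivalence.to admissible⇔Free adm)
    -- mʰ + (1 , -1) is the transpose of m' + (-1 , 1) for the transposed row m' of mʰ.
    gapRight : ∀ {x y} → (x , y) ∈ M → T (admissible (m , m) M (ℤ.+ x ℤ.+ ℤ.+ 1 , ℤ.+ y ℤ.- ℤ.+ 1)) → Gap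
    gapRight {x} {suc y₀} row adm = y₀ , x , row′ ,
      Equivalence.to (free⇔gap row′) (Free-transpose (Equivalence.to admissible⇔Free adm))
      where row′ = symmetricMatrix-swap row

  Gap⇒condIV : Gap → T (condIV (m , m) M)
  Gap⇒condIV (x₀ , y , row , x₀∉ , y<m) = any⁺ _ (lose row (∨⁺ˡ
    (Equivalence.from admissible⇔Free (Equivalence.from (free⇔gap row) (x₀∉ , y<m)))))

  Gap⇒¬isEndSegment : Gap → ¬ T (isEndSegment (suc m) xs)
  Gap⇒¬isEndSegment (x₀ , y , row , x₀∉ , y<m) end
    with ∨⁻ (isUpperSegment (suc m) xs) end
  ... | inj₂ lower = isLowerSegment⇒noGap lower (row⇒∈ row , x₀∉)
  ... | inj₁ upper with m∈ , above ← isUpperSegment-gap upper (row⇒∈ row , x₀∉)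
                   with q , row′ ← ∈⇒row m∈ =
    <⇒≱ y<m (staircase-≤ staircase row (symmetricMatrix-swap row′)
               (above (row⇒∈ (symmetricMatrix-swap row′))))

  ¬isEndSegment⇒Gap : ¬ T (isEndSegment (suc m) xs) → Gap
  ¬isEndSegment⇒Gap ¬end with x₀ , (sx₀∈ , x₀∉) , below ← ¬isEndSegment⇒gap desc ¬end
                         with y , row ← ∈⇒row sx₀∈ =
    x₀ , y , row , x₀∉ , [ below-row , m∉⇒y<m ]′ below
    where
    below-row : ∃[ z ] z ∈ xs × z ≤ x₀ → y < m
    below-row (z , z∈ , z≤x₀) with y′ , row′ ← ∈⇒row z∈ =
      <-≤-trans (staircase-< staircase row′ row (s≤s z≤x₀)) (column-bound row′)
    m∉⇒y<m : m ∉ xs → y < m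
    m∉⇒y<m m∉ = ≤∧≢⇒< (column-bound row) λ { refl → m∉ (row⇒∈ (symmetricMatrix-swap row)) }

  bounded : T (condII (m , m) M)
  bounded = all⁻ _ {xs = M} (All.tabulate λ { {_ , _} row →
    ∧⁺ (≤⇒≤ᵇ (row-bound row)) (≤⇒≤ᵇ (column-bound row)) })

  condIV⇔¬isEndSegment : T (condIV (m , m) M) ⇔ T (not (isEndSegment (suc m) xs))
  condIV⇔¬isEndSegment = mk⇔ (T-not⁺ ∘ Gap⇒¬isEndSegment ∘ condIV⇒Gap)
                              (Gap⇒condIV ∘ ¬isEndSegment⇒Gap ∘ T-not⁻)

eqListℕ-sound : ∀ xs ys → T (eqListℕ xs ys) → xs ≡ ys
eqListℕ-sound []       []       _ = refl
eqListℕ-sound (x ∷ xs) (y ∷ ys) t =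
  let x≡ᵇy , t′ = ∧⁻ (x ℕ.≡ᵇ y) t
  in cong₂ _∷_ (≡ᵇ⇒≡ x y x≡ᵇy) (eqListℕ-sound xs ys t′)

eqListℕ-refl : ∀ xs → T (eqListℕ xs xs)
eqListℕ-refl []       = _
eqListℕ-refl (x ∷ xs) = ∧⁺ (≡⇒≡ᵇ x x refl) (eqListℕ-refl xs)

symmetric⇒≡symmetricMatrix : ∀ M → T (symmetric M) → symmetricMatrix (map proj₁ M) ≡ M
symmetric⇒≡symmetricMatrix M s = begin
  zip (map proj₁ M) (reverse (map proj₁ M))
    ≡⟨ cong (zip (map proj₁ M) ∘ reverse) (eqListℕ-sound (map proj₁ M) (reverse (map proj₂ M)) s) ⟩
  zip (map proj₁ M) (reverse (reverse (map proj₂ M)))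
    ≡⟨ cong (zip (map proj₁ M)) (reverse-involutive (map proj₂ M)) ⟩
  zip (map proj₁ M) (map proj₂ M)
    ≡⟨ zip-map-proj M ⟩
  M ∎
  where open ≡-Reasoning

symmetric-symmetricMatrix : ∀ xs → T (symmetric (symmetricMatrix xs))
symmetric-symmetricMatrix xs = subst T (sym (cong₂ eqListℕ
  (map-proj₁-zip {xs} {reverse xs} len)
  (trans (cong reverse (map-proj₂-zip {xs} len)) (reverse-involutive xs)))) (eqListℕ-refl xs)
  where len = sym (length-reverse xs)

-- The pairs (n̄ , 𝓜)

record Valid (n a b : ℕ) (M : List (ℕ × ℕ)) : Set where
  field
    1≤a       : 1 ≤ a
    1≤b       : 1 ≤ b
    a+b≡n     : a + b ≡ n
    nonempty  : T (nonEmpty M)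
    II        : T (condII (a , b) M)
    III       : T (condIII M)
    IV        : T (condIV (a , b) M)
    a≡b       : a ≡ b
    symmetry  : T (symmetric M)

valid⇔Valid : ∀ {n} a b M → T (valid n ((a , b) , M)) ⇔ Valid n a b M
valid⇔Valid {n} a b M = mk⇔ to from
  where
  to : T (valid n ((a , b) , M)) → Valid n a b M
  to v =
    let 1≤ᵇa , v = ∧⁻ (1 ℕ.≤ᵇ a) v
        1≤ᵇb , v = ∧⁻ (1 ℕ.≤ᵇ b) v
        a+b≡ᵇn , v = ∧⁻ (a + b ℕ.≡ᵇ n) v
        ne , v = ∧⁻ (nonEmpty M) v
        II , v = ∧⁻ (condII (a , b) M) v
        III , v = ∧⁻ (condIII M) v
        IV , v = ∧⁻ (condIV (a , b) M) v
        a≡ᵇb , s = ∧⁻ (a ℕ.≡ᵇ b) v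
    in record { 1≤a = ≤ᵇ⇒≤ 1 a 1≤ᵇa ; 1≤b = ≤ᵇ⇒≤ 1 b 1≤ᵇb ; a+b≡n = ≡ᵇ⇒≡ (a + b) n a+b≡ᵇn
              ; nonempty = ne ; II = II ; III = III ; IV = IV ; a≡b = ≡ᵇ⇒≡ a b a≡ᵇb ; symmetry = s }
  from : Valid n a b M → T (valid n ((a , b) , M))
  from V = ∧⁺ (≤⇒≤ᵇ 1≤a) (∧⁺ (≤⇒≤ᵇ 1≤b) (∧⁺ (≡⇒≡ᵇ (a + b) n a+b≡n) (∧⁺ nonempty
             (∧⁺ II (∧⁺ III (∧⁺ IV (∧⁺ (≡⇒≡ᵇ a b a≡b) symmetry)))))))
    where open Valid V

Valid⇒2*a≡n : ∀ {n a b M} → Valid n a b M → 2 * a ≡ n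
Valid⇒2*a≡n {a = a} V = trans (cong (a +_) (trans (+-identityʳ a) a≡b)) a+b≡n
  where open Valid V

2*a≢1+2*m : ∀ a m → 2 * a ≢ suc (2 * m)
2*a≢1+2*m a m eq = contradiction (∣1⇒≡1 (∣m+n∣m⇒∣n 2∣2m+1 (m∣m*n m))) λ ()
  where
  2∣2m+1 : 2 ∣ 2 * m + 1
  2∣2m+1 = subst (2 ∣_) (trans eq (+-comm 1 (2 * m))) (m∣m*n a)

Pairs-odd↔Fin0 : ∀ m → Pairs (suc (2 * m)) ↔ Fin 0
Pairs-odd↔Fin0 m = mk↔ₛ′ (⊥-elim ∘ empty) (λ ()) (λ ()) (⊥-elim ∘ empty)
  where
  empty : ¬ Pairs (suc (2 * m))
  empty (((a , b) , M) , v) = 2*a≢1+2*m a m (Valid⇒2*a≡n (Equivalence.to (valid⇔Valid a b M) v))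

Pairs-≡ : ∀ {n c c′} {v : T (valid n c)} {w : T (valid n c′)} →
          c ≡ c′ → _≡_ {A = Pairs n} (c , v) (c′ , w)
Pairs-≡ {c = c} refl = cong (c ,_) (T-irrelevant _ _)

condII⇒≤ : ∀ {a b M x y} → T (condII (a , b) M) → (x , y) ∈ M → x ≤ a
condII⇒≤ {a} {b} {M} {x} II row =
  ≤ᵇ⇒≤ x a (proj₁ (∧⁻ (x ℕ.≤ᵇ a) (All.lookup (all⁺ _ M II) row)))

nonEmpty-symmetricMatrix : ∀ {k} xs → T (not (isEndSegment k xs)) → T (nonEmpty (symmetricMatrix xs))
nonEmpty-symmetricMatrix (x ∷ xs) _ =
  nonEmpty⇐map (map-proj₁-zip {x ∷ xs} (sym (length-reverse (x ∷ xs))))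
  where
  nonEmpty⇐map : ∀ {M : List (ℕ × ℕ)} {x xs} → map proj₁ M ≡ x ∷ xs → T (nonEmpty M)
  nonEmpty⇐map {_ ∷ _} _ = _

module ValidEven {m a b M} (V : Valid (2 * m) a b M) where
  open Valid V

  a≡m : a ≡ m
  a≡m = *-cancelˡ-≡ a m 2 (Valid⇒2*a≡n V)

  b≡m : b ≡ m
  b≡m = trans (sym a≡b) a≡m

  M≡ : symmetricMatrix (map proj₁ M) ≡ M
  M≡ = symmetric⇒≡symmetricMatrix M symmetry

  desc : Desc (suc m) (map proj₁ M)
  desc = condIII⇒Desc M III λ {x} row → s≤s (subst (x ≤_) a≡m (condII⇒≤ II row))

  ¬isEndSegment : T (not (isEndSegment (suc m) (map proj₁ M)))
  ¬isEndSegment = Equivalence.to (SymmetricStaircase.condIV⇔¬isEndSegment m (map proj₁ M) desc)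
    (subst₂ (λ c M′ → T (condIV c M′)) (cong₂ _,_ a≡m b≡m) (sym M≡) IV)

Pairs↔¬isEndSegment : ∀ m → 1 ≤ m → Pairs (2 * m) ↔ Subsets (suc m) (not ∘ isEndSegment (suc m))
Pairs↔¬isEndSegment m 1≤m = mk↔ₛ′ to from to∘from from∘to
  where
  to : Pairs (2 * m) → Subsets (suc m) (not ∘ isEndSegment (suc m))
  to (((a , b) , M) , v) = map proj₁ M , desc , ¬isEndSegment
    where open ValidEven {m} (Equivalence.to (valid⇔Valid a b M) v)

  from : Subsets (suc m) (not ∘ isEndSegment (suc m)) → Pairs (2 * m)
  from (xs , d , ¬end) = ((m , m) , M) , Equivalence.from (valid⇔Valid m m M) record
    { 1≤a = 1≤m ; 1≤b = 1≤m ; a+b≡n = cong (m +_) (sym (+-identityʳ m))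
    ; nonempty = nonEmpty-symmetricMatrix xs ¬end
    ; II = bounded ; III = staircase ; IV = Equivalence.from condIV⇔¬isEndSegment ¬end
    ; a≡b = refl ; symmetry = symmetric-symmetricMatrix xs }
    where open SymmetricStaircase m xs d

  to∘from : ∀ s → to (from s) ≡ s
  to∘from (xs , _ , _) = Subsets-≡ (map-proj₁-zip {xs} (sym (length-reverse xs)))

  from∘to : ∀ p → from (to p) ≡ p
  from∘to (((a , b) , M) , v) = Pairs-≡ (cong₂ _,_ (cong₂ _,_ (sym a≡m) (sym b≡m)) M≡)
    where open ValidEven {m} (Equivalence.to (valid⇔Valid a b M) v)

mainTheorem7 : (n : ℕ) → 2 ≤ n →
    ((m : ℕ) → n ≡ suc (2 * m) → Pairs n ↔ Fin 0)
    × ((m : ℕ) → n ≡ 2 * m → Pairs n ↔ Fin (2 ^ (m + 1) ∸ 2 * m ∸ 2))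
mainTheorem7 n 2≤n = odd , even
  where
  odd : (m : ℕ) → n ≡ suc (2 * m) → Pairs n ↔ Fin 0
  odd m refl = Pairs-odd↔Fin0 m
  even : (m : ℕ) → n ≡ 2 * m → Pairs n ↔ Fin (2 ^ (m + 1) ∸ 2 * m ∸ 2)
  even zero    refl = contradiction 2≤n λ ()
  even (suc m) refl = ↔-trans (Pairs↔¬isEndSegment (suc m) (s≤s z≤n))
    (subst (λ c → Subsets (suc (suc m)) P ↔ Fin c) (count-¬isEndSegment (suc m))
           (Subsets↔count (suc (suc m)) P))
    where P = not ∘ isEndSegment (suc (suc m))
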